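{- Let $b,d,q,m$ be positive integers with $d\geq 2$, $m\geq 2$, $(b,q)=1$, and let $q=\prod_{j=1}^r p_j^{e_j}$ be the prime factorization of $q$. For every non-empty $\mathcal S\subseteq\{1,\dots,r\}$, with $c=c_{\mathcal S}>1$, $$\sum_{\mathbf a \in (\mathbb{Z}/c\mathbb{Z})^{m-1}}A(d,\mathbf a,c)=0.$$
   Context: For a positive integer $c$ and $\mathbf a=(a_1,\dots,a_{m-1})$ (taken modulo $c$), let $\nu(d,\mathbf a,c)=\#\{\mathbf x\in(\mathbb{Z}/c\mathbb{Z})^m : bx_i^d-bx_{i+1}^d\equiv a_i \pmod c,\ 1\leq i\leq m-1\}$. For each $j$ set $A(d,\mathbf a,p_j^{e_j})=\nu(d,\mathbf a,p_j^{e_j})-p_j^{e_j}$. For non-empty $\mathcal S\subseteq\{1,\dots,r\}$ set $c_{\mathcal S}=\prod_{j\in\mathcal S}p_j^{e_j}$ and $A(d,\mathbf a,c_{\mathcal S})=\prod_{j\in\mathcal S}A(d,\mathbf a,p_j^{e_j})$, where in each factor $\mathbf a$ is reduced modulo $p_j^{e_j}$. -}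

module Defs where

open import Data.Nat as ℕ using (ℕ; zero; suc; _^_)
open import Data.Nat.Divisibility using (_∣?_)
open import Data.Integer as ℤ using (ℤ; +_; ∣_∣)
import Data.Bool
open import Data.Bool using (Bool; true; false; _∧_; if_then_else_)
open import Data.List using (List; []; _∷_; map; concatMap; upTo; filter; length; foldr)
open import Data.Vec using (Vec; []; _∷_)
open import Data.Fin using (Fin)
open import Data.Fin.Subset using (Subset; _∈_)
open import Data.Fin.Subset.Properties using (_∈?_)
open import Data.List.Base using () renaming (tabulate to tabulateL)
open import Relation.Nullary.Decidable using (⌊_⌋; does)

-- All vectors in {0,…,c-1}^n, i.e. a complete list of representatives of (ℤ/cℤ)^n.
allVecs : (n c : ℕ) → List (Vec ℕ n)
allVecs zero c = [] ∷ []
allVecs (suc n) c = concatMap (λ x → map (x ∷_) (allVecs n c)) (upTo c)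

congB : (b d c x y a : ℕ) → Bool
congB b d c x y a =
  ⌊ c ∣? ∣ (+ (b ℕ.* x ^ d)) ℤ.- (+ (b ℕ.* y ^ d)) ℤ.- (+ a) ∣ ⌋

chain : (b d c : ℕ) → {n : ℕ} → Vec ℕ (suc n) → Vec ℕ n → Bool
chain b d c (x ∷ []) [] = true
chain b d c (x ∷ y ∷ xs) (a ∷ as) = congB b d c x y a ∧ chain b d c (y ∷ xs) as

-- ν(d, a, c) with a ∈ ℕ^(m-1) (only its class mod c matters), x ranging over (ℤ/cℤ)^m,
-- where m = suc n.
ν : (b d : ℕ) {n : ℕ} (a : Vec ℕ n) (c : ℕ) → ℕ
ν b d {n} a c = length (filter (λ x → chain b d c x a Data.Bool.≟ true) (allVecs (suc n) c))

Aloc : (b d : ℕ) {n : ℕ} (a : Vec ℕ n) (pe : ℕ) → ℤ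
Aloc b d a pe = (+ ν b d a pe) ℤ.- (+ pe)

prodℤ : {r : ℕ} → Subset r → (Fin r → ℤ) → ℤ
prodℤ {r} S f = foldr (λ j acc → if does (j ∈? S) then f j ℤ.* acc else acc) (+ 1) (tabulateL {n = r} (λ j → j))

prodℕ : {r : ℕ} → Subset r → (Fin r → ℕ) → ℕ
prodℕ {r} S f = foldr (λ j acc → if does (j ∈? S) then f j ℕ.* acc else acc) 1 (tabulateL {n = r} (λ j → j))

prodAll : {r : ℕ} → (Fin r → ℕ) → ℕ
prodAll {r} f = foldr (λ j acc → f j ℕ.* acc) 1 (tabulateL {n = r} (λ j → j))

cS : {r : ℕ} → (p e : Fin r → ℕ) → Subset r → ℕ
cS p e S = prodℕ S (λ j → p j ^ e j)

-- A(d, a, c_S) = ∏_{j ∈ S} A(d, a mod p_j^{e_j}, p_j^{e_j})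
AS : (b d : ℕ) {r n : ℕ} (p e : Fin r → ℕ) (S : Subset r) (a : Vec ℕ n) → ℤ
AS b d p e S a = prodℤ S (λ j → Aloc b d a (p j ^ e j))

sumℤ : {A : Set} → List A → (A → ℤ) → ℤ
sumℤ xs f = foldr (λ x acc → f x ℤ.+ acc) (+ 0) xs

module Submission where

-- (1) Local vanishing: for every modulus c ≥ 1, Σ_{a ∈ (ℤ/c)^n} A(d, a, c) = 0.  The sum of
--     ν(d, a, c) over a counts the pairs (x, a) with x ∈ (ℤ/c)^(n+1) solving the chain
--     b x_i^d - b x_{i+1}^d ≡ a_i (mod c); each x determines a uniquely, so it equals
--     c^(n+1) = Σ_a c.
-- (2) Periodicity: A(d, a, c) only depends on a modulo any multiple of c.
-- (3) Chinese remainder theorem: for coprime P, Q, g of period P and h of period Q,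
--     Σ_{a ∈ (ℤ/PQ)^n} g(a) h(a) = (Σ_{(ℤ/P)^n} g) (Σ_{(ℤ/Q)^n} h).
-- (4) Distinct prime powers are coprime, so unfolding the product A(d, a, c_S) one index at a
--     time with (3), the factor of the first index in S contributes the vanishing sum (1).

open import Defs
open import Data.Nat using (ℕ; _≤_; _^_; _∸_; NonZero; _%_)
open import Data.Nat.Primality using (Prime; prime⇒nonZero)
open import Data.Nat.Coprimality using (Coprime)
open import Data.Nat.Divisibility using () renaming (_∣_ to _∣ℕ_)
open import Data.Nat.Properties using (m^n≢0)
open import Data.Integer using (ℤ; +_)
open import Data.Fin using (Fin)
open import Data.Fin.Subset using (Subset; Nonempty)
open import Data.Vec using (Vec)
open import Data.List using (allFin)
import Data.List.Relation.Unary.Any as Any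
open import Data.List.Membership.Propositional.Properties using (∈-allFin)
open import Data.List.Relation.Unary.Unique.Propositional.Properties using (allFin⁺)
open import Data.Product using (_,_)
open import Function using (_∘_)
open import Function.Definitions using (Injective)
open import Relation.Binary.PropositionalEquality using (_≡_; _≢_; refl)

module FiniteSums where

  open import Data.Integer using (_+_; _*_; -_)
  open import Data.Integer.Properties
    using (+-identityˡ; +-identityʳ; +-assoc; *-identityˡ; *-identityʳ; *-zeroˡ; *-zeroʳ; *-comm;
           *-distribˡ-+; *-distribʳ-+; neg-distrib-+; +-commutativeSemigroup)
  open import Algebra.Properties.CommutativeSemigroup +-commutativeSemigroup using (interchange)
  open import Data.Bool using (Bool; true; false; _∧_; T)
  import Data.Bool
  open import Data.Empty using (⊥-elim)
  open import Data.List using (List; []; _∷_; map; concatMap; filter; length; _++_)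
  open import Data.List.Membership.Propositional using (_∈_)
  open import Data.List.Relation.Unary.Any using (here; there)
  import Data.List.Relation.Unary.All as All
  open import Data.List.Relation.Unary.AllPairs using (_∷_)
  open import Data.List.Relation.Unary.Unique.Propositional using (Unique)
  open import Relation.Binary.Definitions using (DecidableEquality)
  open import Relation.Nullary using (Dec; yes; no; does)
  open import Relation.Binary.PropositionalEquality
  open ≡-Reasoning

  sum-++ : {A : Set} (xs ys : List A) (f : A → ℤ) →
    sumℤ (xs ++ ys) f ≡ sumℤ xs f + sumℤ ys f
  sum-++ [] ys f = sym (+-identityˡ _)
  sum-++ (x ∷ xs) ys f = trans (cong (_+_ (f x)) (sum-++ xs ys f)) (sym (+-assoc (f x) _ _))

  sum-map : {A B : Set} (h : A → B) (xs : List A) (f : B → ℤ) →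
    sumℤ (map h xs) f ≡ sumℤ xs (λ x → f (h x))
  sum-map h [] f = refl
  sum-map h (x ∷ xs) f = cong (_+_ (f (h x))) (sum-map h xs f)

  sum-concatMap : {A B : Set} (g : A → List B) (xs : List A) (f : B → ℤ) →
    sumℤ (concatMap g xs) f ≡ sumℤ xs (λ x → sumℤ (g x) f)
  sum-concatMap g [] f = refl
  sum-concatMap g (x ∷ xs) f =
    trans (sum-++ (g x) _ f) (cong (_+_ (sumℤ (g x) f)) (sum-concatMap g xs f))

  sum-cong-∈ : {A : Set} (xs : List A) {f g : A → ℤ} →
    (∀ {x} → x ∈ xs → f x ≡ g x) → sumℤ xs f ≡ sumℤ xs g
  sum-cong-∈ [] e = refl
  sum-cong-∈ (x ∷ xs) e = cong₂ _+_ (e (here refl)) (sum-cong-∈ xs (λ x∈ → e (there x∈)))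

  sum-cong : {A : Set} (xs : List A) {f g : A → ℤ} → (∀ x → f x ≡ g x) → sumℤ xs f ≡ sumℤ xs g
  sum-cong xs e = sum-cong-∈ xs (λ {x} _ → e x)

  sum-zero : {A : Set} (xs : List A) → sumℤ xs (λ _ → + 0) ≡ + 0
  sum-zero [] = refl
  sum-zero (x ∷ xs) = trans (+-identityˡ _) (sum-zero xs)

  sum-+ : {A : Set} (xs : List A) (f g : A → ℤ) →
    sumℤ xs (λ x → f x + g x) ≡ sumℤ xs f + sumℤ xs g
  sum-+ [] f g = refl
  sum-+ (x ∷ xs) f g =
    trans (cong (_+_ (f x + g x)) (sum-+ xs f g)) (interchange (f x) (g x) _ _)

  sum-neg : {A : Set} (xs : List A) (f : A → ℤ) → sumℤ xs (λ x → - f x) ≡ - sumℤ xs f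
  sum-neg [] f = refl
  sum-neg (x ∷ xs) f = trans (cong (_+_ (- f x)) (sum-neg xs f)) (sym (neg-distrib-+ (f x) _))

  sum-*ˡ : {A : Set} (xs : List A) (k : ℤ) (f : A → ℤ) →
    sumℤ xs (λ x → k * f x) ≡ k * sumℤ xs f
  sum-*ˡ [] k f = sym (*-zeroʳ k)
  sum-*ˡ (x ∷ xs) k f = trans (cong (_+_ (k * f x)) (sum-*ˡ xs k f)) (sym (*-distribˡ-+ k (f x) _))

  sum-*ʳ : {A : Set} (xs : List A) (k : ℤ) (f : A → ℤ) →
    sumℤ xs (λ x → f x * k) ≡ sumℤ xs f * k
  sum-*ʳ xs k f = trans (sum-cong xs (λ x → *-comm (f x) k)) (trans (sum-*ˡ xs k f) (*-comm k _))

  sum-swap : {A B : Set} (xs : List A) (ys : List B) (f : A → B → ℤ) →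
    sumℤ xs (λ x → sumℤ ys (f x)) ≡ sumℤ ys (λ y → sumℤ xs (λ x → f x y))
  sum-swap [] ys f = sym (sum-zero ys)
  sum-swap (x ∷ xs) ys f = trans (cong (_+_ (sumℤ ys (f x))) (sum-swap xs ys f))
    (sym (sum-+ ys (f x) (λ y → sumℤ xs (λ x → f x y))))

  sum-const : {A : Set} (xs : List A) (k : ℤ) → sumℤ xs (λ _ → k) ≡ + length xs * k
  sum-const [] k = sym (*-zeroˡ k)
  sum-const (x ∷ xs) k = begin
    k + sumℤ xs (λ _ → k)     ≡⟨ cong (_+_ k) (sum-const xs k) ⟩
    k + + length xs * k       ≡⟨ cong (_+ + length xs * k) (sym (*-identityˡ k)) ⟩
    + 1 * k + + length xs * k ≡⟨ sym (*-distribʳ-+ k (+ 1) (+ length xs)) ⟩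
    + length (x ∷ xs) * k     ∎

  𝟙 : Bool → ℤ
  𝟙 true = + 1
  𝟙 false = + 0

  𝟙-∧ : ∀ a b → 𝟙 (a ∧ b) ≡ 𝟙 a * 𝟙 b
  𝟙-∧ true b = sym (*-identityˡ (𝟙 b))
  𝟙-∧ false b = refl

  𝟙-dec : {b : Bool} {Q : Set} (q? : Dec Q) → (T b → Q) → (Q → T b) → 𝟙 b ≡ 𝟙 (does q?)
  𝟙-dec {true} (yes _) _ _ = refl
  𝟙-dec {true} (no ¬q) to _ = ⊥-elim (¬q (to _))
  𝟙-dec {false} (yes q) _ from = ⊥-elim (from q)
  𝟙-dec {false} (no _) _ _ = refl

  T-ext : {a b : Bool} → (T a → T b) → (T b → T a) → a ≡ b
  T-ext {true} {true} _ _ = refl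
  T-ext {true} {false} to _ = ⊥-elim (to _)
  T-ext {false} {true} _ from = ⊥-elim (from _)
  T-ext {false} {false} _ _ = refl

  count-filter : {A : Set} (P : A → Bool) (xs : List A) →
    + length (filter (λ x → P x Data.Bool.≟ true) xs) ≡ sumℤ xs (λ x → 𝟙 (P x))
  count-filter P [] = refl
  count-filter P (x ∷ xs) with P x
  ... | true = cong (_+_ (+ 1)) (count-filter P xs)
  ... | false = trans (count-filter P xs) (sym (+-identityˡ _))

  module _ {A : Set} (_≟_ : DecidableEquality A) where

    sum-delta : (ys : List A) {y : A} (f : A → ℤ) → Unique ys → y ∈ ys →
      sumℤ ys (λ z → 𝟙 (does (z ≟ y)) * f z) ≡ f y
    sum-delta (z ∷ ys) {y} f (z∉ys ∷ uniq) y∈ with z ≟ y | y∈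
    ... | yes refl | _ = trans (cong₂ _+_ (*-identityˡ (f z)) rest-vanishes) (+-identityʳ (f z))
      where
        rest-vanishes : sumℤ ys (λ w → 𝟙 (does (w ≟ z)) * f w) ≡ + 0
        rest-vanishes = trans (sum-cong-∈ ys λ {w} w∈ → cong (λ t → 𝟙 t * f w) (dec-false w∈))
                              (sum-zero ys)
          where
            dec-false : ∀ {w} → w ∈ ys → does (w ≟ z) ≡ false
            dec-false {w} w∈ with w ≟ z
            ... | yes refl = ⊥-elim (All.lookup z∉ys w∈ refl)
            ... | no _ = refl
    ... | no z≢y | here z≡y = ⊥-elim (z≢y (sym z≡y))
    ... | no _ | there y∈ys = trans (+-identityˡ _) (sum-delta ys f uniq y∈ys)

    count-unique : (ys : List A) {y : A} (P : A → Bool) → Unique ys → y ∈ ys →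
      (∀ {z} → z ∈ ys → T (P z) → z ≡ y) → (∀ {z} → z ∈ ys → z ≡ y → T (P z)) →
      sumℤ ys (λ z → 𝟙 (P z)) ≡ + 1
    count-unique ys {y} P uniq y∈ only-y at-y = begin
      sumℤ ys (λ z → 𝟙 (P z))                   ≡⟨ sum-cong-∈ ys (λ z∈ →
        trans (𝟙-dec (_ ≟ y) (only-y z∈) (at-y z∈)) (sym (*-identityʳ _))) ⟩
      sumℤ ys (λ z → 𝟙 (does (z ≟ y)) * + 1)   ≡⟨ sum-delta ys (λ _ → + 1) uniq y∈ ⟩
      + 1                                       ∎

module Boxes where

  open FiniteSums
  open import Data.Nat using (suc)
  open import Data.Integer using (_*_)
  open import Data.Integer.Properties using (*-identityʳ)
  open import Data.List using (upTo; map)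
  open import Data.List.Properties using (length-upTo)
  open import Data.Vec using (_∷_)
  open import Relation.Binary.PropositionalEquality
  open ≡-Reasoning

  sum-box-suc : ∀ n c (f : Vec ℕ (suc n) → ℤ) →
    sumℤ (allVecs (suc n) c) f ≡ sumℤ (upTo c) (λ s → sumℤ (allVecs n c) (λ u → f (s ∷ u)))
  sum-box-suc n c f = trans (sum-concatMap (λ s → map (s ∷_) (allVecs n c)) (upTo c) f)
    (sum-cong (upTo c) (λ s → sum-map (s ∷_) (allVecs n c) f))

  sum-box-product : ∀ n c (f : Vec ℕ (suc n) → ℤ) (g : ℕ → ℤ) (h : Vec ℕ n → ℤ) →
    (∀ s u → f (s ∷ u) ≡ g s * h u) →
    sumℤ (allVecs (suc n) c) f ≡ sumℤ (upTo c) g * sumℤ (allVecs n c) h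
  sum-box-product n c f g h split = begin
    sumℤ (allVecs (suc n) c) f                                 ≡⟨ sum-box-suc n c f ⟩
    sumℤ (upTo c) (λ s → sumℤ (allVecs n c) (λ u → f (s ∷ u)))
      ≡⟨ sum-cong (upTo c) (λ s →
           trans (sum-cong (allVecs n c) (split s)) (sum-*ˡ (allVecs n c) (g s) h)) ⟩
    sumℤ (upTo c) (λ s → g s * sumℤ (allVecs n c) h)         ≡⟨ sum-*ʳ (upTo c) _ g ⟩
    sumℤ (upTo c) g * sumℤ (allVecs n c) h                    ∎

  box-size : ∀ n c → sumℤ (allVecs (suc n) c) (λ _ → + 1) ≡ sumℤ (allVecs n c) (λ _ → + c)
  box-size n c = begin
    sumℤ (allVecs (suc n) c) (λ _ → + 1)                  ≡⟨ sum-box-suc n c (λ _ → + 1) ⟩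
    sumℤ (upTo c) (λ _ → sumℤ (allVecs n c) (λ _ → + 1))
      ≡⟨ sum-swap (upTo c) (allVecs n c) (λ _ _ → + 1) ⟩
    sumℤ (allVecs n c) (λ _ → sumℤ (upTo c) (λ _ → + 1))  ≡⟨ sum-cong (allVecs n c) (λ _ → range-size) ⟩
    sumℤ (allVecs n c) (λ _ → + c)                        ∎
    where
      range-size : sumℤ (upTo c) (λ _ → + 1) ≡ + c
      range-size = trans (sum-const (upTo c) (+ 1))
                         (trans (*-identityʳ _) (cong +_ (length-upTo c)))

module Congruences where

  open import Data.Nat as ℕ using (zero; suc; _<_; _∸_)
  import Data.Nat.Properties as ℕP
  import Data.Nat.Divisibility as ℕ∣
  open import Data.Nat.Coprimality using (coprime-divisor)
  import Data.Nat.Coprimality as Coprime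
  open import Data.Integer using (_+_; _-_; _*_; -_; _⊖_; ∣_∣; _%ℕ_; _/ℕ_)
  open import Data.Integer.Properties using ([+m]-[+n]≡m⊖n; ∣⊖∣-≤; ∣m⊖n∣≡∣n⊖m∣)
  open import Data.Integer.DivMod using (a≡a%ℕn+[a/ℕn]*n; n%ℕd<d)
  open import Data.Integer.Divisibility.Signed
    using (_∣_; divides; ∣ᵤ⇒∣; ∣⇒∣ᵤ; ∣-trans; ∣m∣n⇒∣m+n; ∣m⇒∣-m)
  open import Data.Integer.Tactic.RingSolver using (solve-∀)
  open import Data.Sum using (inj₁; inj₂)
  open import Data.Empty using (⊥-elim)
  open import Relation.Binary.PropositionalEquality
  open ≡-Reasoning

  infix 4 _≈_mod_
  record _≈_mod_ (x y : ℤ) (c : ℕ) : Set where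
    constructor congruent
    field modulus-divides : + c ∣ x - y
  open _≈_mod_ public

  mod-sym : ∀ {c x y} → x ≈ y mod c → y ≈ x mod c
  mod-sym {c} {x} {y} (congruent c∣x-y) =
    congruent (subst (+ c ∣_) (negate-difference x y) (∣m⇒∣-m c∣x-y))
    where
      negate-difference : ∀ x y → - (x - y) ≡ y - x
      negate-difference = solve-∀

  mod-trans : ∀ {c x y z} → x ≈ y mod c → y ≈ z mod c → x ≈ z mod c
  mod-trans {c} {x} {y} {z} (congruent c∣x-y) (congruent c∣y-z) =
    congruent (subst (+ c ∣_) (telescope x y z) (∣m∣n⇒∣m+n c∣x-y c∣y-z))
    where
      telescope : ∀ x y z → (x - y) + (y - z) ≡ x - z
      telescope = solve-∀

  mod-divisor : ∀ {c M x y} → c ∣ℕ M → x ≈ y mod M → x ≈ y mod c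
  mod-divisor c∣M (congruent M∣x-y) = congruent (∣-trans (∣ᵤ⇒∣ c∣M) M∣x-y)

  coprime-∣-* : ∀ {P Q k} → Coprime P Q → P ∣ℕ k → Q ∣ℕ k → P ℕ.* Q ∣ℕ k
  coprime-∣-* {P} {Q} cop (ℕ∣.divides j refl) Q∣jP =
    subst (P ℕ.* Q ∣ℕ_) (ℕP.*-comm P j) (ℕ∣.*-monoʳ-∣ P Q∣j)
    where
      Q∣j : Q ∣ℕ j
      Q∣j = coprime-divisor (Coprime.sym cop) (subst (Q ∣ℕ_) (ℕP.*-comm j P) Q∣jP)

  mod-coprime-* : ∀ {P Q x y} → Coprime P Q →
    x ≈ y mod P → x ≈ y mod Q → x ≈ y mod P ℕ.* Q
  mod-coprime-* cop (congruent P∣x-y) (congruent Q∣x-y) =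
    congruent (∣ᵤ⇒∣ (coprime-∣-* cop (∣⇒∣ᵤ P∣x-y) (∣⇒∣ᵤ Q∣x-y)))

  mod-residue : ∀ c {{_ : NonZero c}} z → z ≈ + (z %ℕ c) mod c
  mod-residue c z = congruent (divides (z /ℕ c) (begin
    z - + r                 ≡⟨ cong (_- + r) (a≡a%ℕn+[a/ℕn]*n z c) ⟩
    (+ r + q * + c) - + r   ≡⟨ cancel (+ r) q (+ c) ⟩
    q * + c                 ∎))
    where
      r = z %ℕ c
      q = z /ℕ c
      cancel : ∀ r q c → (r + q * c) - r ≡ q * c
      cancel = solve-∀

  multiple-below⇒zero : ∀ {c k} → c ∣ℕ k → k < c → k ≡ 0
  multiple-below⇒zero {k = zero} _ _ = refl
  multiple-below⇒zero {k = suc k} c∣k k<c = ⊥-elim (ℕP.<⇒≱ k<c (ℕ∣.∣⇒≤ c∣k))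

  ordered-congruent⇒≡ : ∀ {c i j} → i ℕ.≤ j → j < c → c ∣ℕ j ∸ i → i ≡ j
  ordered-congruent⇒≡ {i = i} {j} i≤j j<c c∣ = ℕP.≤-antisym i≤j
    (ℕP.m∸n≡0⇒m≤n (multiple-below⇒zero c∣ (ℕP.≤-<-trans (ℕP.m∸n≤m j i) j<c)))

  residues-congruent⇒≡ : ∀ {c m n} → m < c → n < c → c ∣ℕ ∣ m ⊖ n ∣ → m ≡ n
  residues-congruent⇒≡ {c} {m} {n} m<c n<c c∣ with ℕP.≤-total m n
  ... | inj₁ m≤n = ordered-congruent⇒≡ m≤n n<c (subst (c ∣ℕ_) (∣⊖∣-≤ m≤n) c∣)
  ... | inj₂ n≤m = sym (ordered-congruent⇒≡ n≤m m<c
                          (subst (c ∣ℕ_) (trans (∣m⊖n∣≡∣n⊖m∣ m n) (∣⊖∣-≤ n≤m)) c∣))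

  residue-unique : ∀ c {{_ : NonZero c}} z {a} → a < c → z ≈ + a mod c → z %ℕ c ≡ a
  residue-unique c z {a} a<c z≈a = residues-congruent⇒≡ (n%ℕd<d z c) a<c
    (subst (c ∣ℕ_) (cong ∣_∣ ([+m]-[+n]≡m⊖n (z %ℕ c) a))
           (∣⇒∣ᵤ (modulus-divides (mod-trans (mod-sym (mod-residue c z)) z≈a))))

  same-residue⇒mod : ∀ c {{_ : NonZero c}} z z' → z %ℕ c ≡ z' %ℕ c → z ≈ z' mod c
  same-residue⇒mod c z z' eq = mod-trans (mod-residue c z)
    (subst (λ r → + r ≈ z' mod c) (sym eq) (mod-sym (mod-residue c z')))

  residue-of-reduction : ∀ c M {{_ : NonZero c}} {{_ : NonZero M}} z {a} → c ∣ℕ M → a < c →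
    z ≈ + a mod c → (z %ℕ M) ℕ.% c ≡ a
  residue-of-reduction c M z c∣M a<c z≈a = residue-unique c (+ (z %ℕ M)) a<c
    (mod-trans (mod-divisor c∣M (mod-sym (mod-residue M z))) z≈a)

module LocalFactor (b d c : ℕ) {{_ : NonZero c}} where

  open FiniteSums
  open Boxes
  open Congruences
  open import Data.Nat as ℕ using (zero; suc)
  open import Data.Integer using (_+_; _-_; _*_; -_)
  open import Data.Integer.Properties using (+-inverseʳ)
  open import Data.Integer.DivMod using (n%ℕd<d)
  open import Data.Integer.Divisibility.Signed using (∣ᵤ⇒∣; ∣⇒∣ᵤ)
  open import Data.List using (upTo)
  open import Data.List.Membership.Propositional.Properties using (∈-upTo⁺; ∈-upTo⁻)
  open import Data.List.Relation.Unary.Unique.Propositional.Properties using (upTo⁺)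
  import Data.Vec as Vec
  open import Data.Vec using ([]; _∷_)
  open import Data.Bool using (T; _∧_)
  open import Relation.Nullary.Decidable using (toWitness; fromWitness)
  open import Relation.Binary.PropositionalEquality
  open ≡-Reasoning

  difference : ℕ → ℕ → ℤ
  difference x y = + (b ℕ.* x ^ d) - + (b ℕ.* y ^ d)

  congB-sound : ∀ {x y a} → T (congB b d c x y a) → difference x y ≈ + a mod c
  congB-sound t = congruent (∣ᵤ⇒∣ (toWitness t))

  congB-complete : ∀ {x y a} → difference x y ≈ + a mod c → T (congB b d c x y a)
  congB-complete (congruent c∣) = fromWitness (∣⇒∣ᵤ c∣)

  link-count : ∀ x y → sumℤ (upTo c) (λ a → 𝟙 (congB b d c x y a)) ≡ + 1
  link-count x y = count-unique ℕ._≟_ (upTo c) (congB b d c x y) (upTo⁺ c)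
    (∈-upTo⁺ (n%ℕd<d (difference x y) c))
    (λ a∈ t → sym (residue-unique c (difference x y) (∈-upTo⁻ a∈) (congB-sound t)))
    (λ { _ refl → congB-complete (mod-residue c (difference x y)) })

  chain-count : ∀ n (x : Vec ℕ (suc n)) → sumℤ (allVecs n c) (λ a → 𝟙 (chain b d c x a)) ≡ + 1
  chain-count zero (x₀ ∷ []) = refl
  chain-count (suc n) (x₀ ∷ x₁ ∷ xs) = begin
    sumℤ (allVecs (suc n) c) (λ a → 𝟙 (chain b d c (x₀ ∷ x₁ ∷ xs) a))
      ≡⟨ sum-box-product n c (λ a → 𝟙 (chain b d c (x₀ ∷ x₁ ∷ xs) a)) first-link rest
           (λ a₀ as → 𝟙-∧ (congB b d c x₀ x₁ a₀) (chain b d c (x₁ ∷ xs) as)) ⟩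
    sumℤ (upTo c) first-link * sumℤ (allVecs n c) rest
      ≡⟨ cong₂ _*_ (link-count x₀ x₁) (chain-count n (x₁ ∷ xs)) ⟩
    + 1 ∎
    where
      first-link : ℕ → ℤ
      first-link a₀ = 𝟙 (congB b d c x₀ x₁ a₀)
      rest : Vec ℕ n → ℤ
      rest as = 𝟙 (chain b d c (x₁ ∷ xs) as)

  ν-as-sum : ∀ {n} (a : Vec ℕ n) →
    + ν b d a c ≡ sumℤ (allVecs (suc n) c) (λ x → 𝟙 (chain b d c x a))
  ν-as-sum {n} a = count-filter (λ x → chain b d c x a) (allVecs (suc n) c)

  -- Σ_a A(d, a, c) = 0: every x solves the system for exactly one a, so Σ_a ν(d, a, c) = c^(n+1).
  local-sum-zero : ∀ n → sumℤ (allVecs n c) (λ a → Aloc b d a c) ≡ + 0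
  local-sum-zero n = begin
    sumℤ (allVecs n c) (λ a → + ν b d a c + - + c)
      ≡⟨ sum-+ (allVecs n c) (λ a → + ν b d a c) (λ _ → - + c) ⟩
    sumℤ (allVecs n c) (λ a → + ν b d a c) + sumℤ (allVecs n c) (λ _ → - + c)
      ≡⟨ cong₂ _+_ all-solutions (sum-neg (allVecs n c) (λ _ → + c)) ⟩
    sumℤ (allVecs n c) (λ _ → + c) + - sumℤ (allVecs n c) (λ _ → + c)
      ≡⟨ +-inverseʳ (sumℤ (allVecs n c) (λ _ → + c)) ⟩
    + 0 ∎
    where
      all-solutions : sumℤ (allVecs n c) (λ a → + ν b d a c) ≡ sumℤ (allVecs n c) (λ _ → + c)
      all-solutions = begin
        sumℤ (allVecs n c) (λ a → + ν b d a c)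
          ≡⟨ sum-cong (allVecs n c) ν-as-sum ⟩
        sumℤ (allVecs n c) (λ a → sumℤ (allVecs (suc n) c) (λ x → 𝟙 (chain b d c x a)))
          ≡⟨ sum-swap (allVecs n c) (allVecs (suc n) c) (λ a x → 𝟙 (chain b d c x a)) ⟩
        sumℤ (allVecs (suc n) c) (λ x → sumℤ (allVecs n c) (λ a → 𝟙 (chain b d c x a)))
          ≡⟨ sum-cong (allVecs (suc n) c) (chain-count n) ⟩
        sumℤ (allVecs (suc n) c) (λ _ → + 1)
          ≡⟨ box-size n c ⟩
        sumℤ (allVecs n c) (λ _ → + c) ∎

  module _ (M : ℕ) {{_ : NonZero M}} (c∣M : c ∣ℕ M) where

    link-periodic : ∀ x y a → congB b d c x y a ≡ congB b d c x y (a % M)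
    link-periodic x y a = T-ext
      (λ t → congB-complete (mod-trans (congB-sound t) reduce))
      (λ t → congB-complete (mod-trans (congB-sound t) (mod-sym reduce)))
      where
        reduce : + a ≈ + (a % M) mod c
        reduce = mod-divisor c∣M (mod-residue M (+ a))

    chain-periodic : ∀ {n} (x : Vec ℕ (suc n)) (a : Vec ℕ n) →
      chain b d c x a ≡ chain b d c x (Vec.map (_% M) a)
    chain-periodic (x₀ ∷ []) [] = refl
    chain-periodic (x₀ ∷ x₁ ∷ xs) (a₀ ∷ as) =
      cong₂ _∧_ (link-periodic x₀ x₁ a₀) (chain-periodic (x₁ ∷ xs) as)

    local-periodic : ∀ {n} (a : Vec ℕ n) → Aloc b d a c ≡ Aloc b d (Vec.map (_% M) a) c
    local-periodic {n} a = cong (_- + c) (begin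
      + ν b d a c                                            ≡⟨ ν-as-sum a ⟩
      sumℤ (allVecs (suc n) c) (λ x → 𝟙 (chain b d c x a))
        ≡⟨ sum-cong (allVecs (suc n) c) (λ x → cong 𝟙 (chain-periodic x a)) ⟩
      sumℤ (allVecs (suc n) c) (λ x → 𝟙 (chain b d c x (Vec.map (_% M) a)))
        ≡⟨ sym (ν-as-sum (Vec.map (_% M) a)) ⟩
      + ν b d (Vec.map (_% M) a) c                           ∎)

module ChineseRemainder (P Q : ℕ) {{_ : NonZero P}} {{_ : NonZero Q}} (cop : Coprime P Q) where

  open FiniteSums
  open Boxes
  open Congruences
  open import Data.Nat as ℕ using (suc; zero; _<_)
  import Data.Nat.Properties as ℕP
  open import Data.Nat.DivMod using (m<n⇒m%n≡m; m%n<n)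
  open import Data.Nat.Divisibility using (m∣m*n; n∣m*n)
  open import Data.Nat.Coprimality using (coprime-Bézout)
  open import Data.Nat.GCD using (module Bézout)
  open import Data.Integer using (_+_; _-_; _*_; -_; _%ℕ_)
  open import Data.Integer.Properties
    using (pos-*; +-comm; +-identityʳ; *-assoc; *-identityʳ; *-identityˡ)
  open import Data.Integer.DivMod using (n%ℕd<d)
  open import Data.Integer.Divisibility.Signed using (divides)
  open import Data.Integer.Tactic.RingSolver using (solve-∀)
  open import Data.List using (upTo)
  open import Data.List.Membership.Propositional using (_∈_)
  open import Data.List.Membership.Propositional.Properties using (∈-upTo⁺; ∈-upTo⁻)
  open import Data.List.Relation.Unary.Unique.Propositional.Properties using (upTo⁺)
  import Data.Vec as Vec
  open import Data.Vec using (_∷_)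
  open import Data.Bool using (Bool; T; _∧_)
  open import Data.Bool.Properties using (T-∧)
  open import Data.Product using (∃; ∃₂; _×_; _,_)
  open import Function.Bundles using (Equivalence)
  open import Relation.Nullary using (does)
  open import Relation.Binary.PropositionalEquality
  open ≡-Reasoning

  instance
    PQ-nonzero : NonZero (P ℕ.* Q)
    PQ-nonzero = ℕP.m*n≢0 P Q

  bezout-in-ℤ : ∀ {m n u v} → 1 ℕ.+ u ℕ.* n ≡ v ℕ.* m → + v * + m + - + u * + n ≡ + 1
  bezout-in-ℤ {m} {n} {u} {v} eq = begin
    + v * + m + - + u * + n          ≡⟨ cong (_+ - + u * + n) (sym (pos-* v m)) ⟩
    + (v ℕ.* m) + - + u * + n        ≡⟨ cong (λ k → + k + - + u * + n) (sym eq) ⟩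
    + 1 + + (u ℕ.* n) + - + u * + n  ≡⟨ cong (λ k → + 1 + k + - + u * + n) (pos-* u n) ⟩
    + 1 + + u * + n + - + u * + n    ≡⟨ cancel (+ u) (+ n) ⟩
    + 1                              ∎
    where
      cancel : ∀ u n → + 1 + u * n + - u * n ≡ + 1
      cancel = solve-∀

  bezout : ∃₂ λ α β → α * + P + β * + Q ≡ + 1
  bezout with coprime-Bézout cop
  ... | Bézout.+- x y eq = + x , - + y , bezout-in-ℤ {P} {Q} {y} {x} eq
  ... | Bézout.-+ x y eq =
    - + x , + y , trans (+-comm (- + x * + P) (+ y * + Q)) (bezout-in-ℤ {Q} {P} {x} {y} eq)

  bezout-combination : ∀ α β s t → α * + P + β * + Q ≡ + 1 →
    (s * (β * + Q) + t * (α * + P) ≈ s mod P) × (s * (β * + Q) + t * (α * + P) ≈ t mod Q)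
  bezout-combination α β s t unit =
    congruent (divides ((t - s) * α) (begin
      z - s                                ≡⟨ cong (λ k → z - k) (sym (expand s)) ⟩
      z - s * (α * + P + β * + Q)          ≡⟨ P-part s t α β (+ P) (+ Q) ⟩
      ((t - s) * α) * + P                  ∎)) ,
    congruent (divides ((s - t) * β) (begin
      z - t                                ≡⟨ cong (λ k → z - k) (sym (expand t)) ⟩
      z - t * (α * + P + β * + Q)          ≡⟨ Q-part s t α β (+ P) (+ Q) ⟩
      ((s - t) * β) * + Q                  ∎))
    where
      z = s * (β * + Q) + t * (α * + P)
      expand : ∀ k → k * (α * + P + β * + Q) ≡ k
      expand k = trans (cong (k *_) unit) (*-identityʳ k)
      P-part : ∀ s t α β P Q →
        (s * (β * Q) + t * (α * P)) - s * (α * P + β * Q) ≡ ((t - s) * α) * P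
      P-part = solve-∀
      Q-part : ∀ s t α β P Q →
        (s * (β * Q) + t * (α * P)) - t * (α * P + β * Q) ≡ ((s - t) * β) * Q
      Q-part = solve-∀

  crt-exists : ∀ {s t} → s < P → t < Q → ∃ λ w → w < P ℕ.* Q × w % P ≡ s × w % Q ≡ t
  crt-exists {s} {t} s<P t<Q with bezout
  ... | α , β , unit with bezout-combination α β (+ s) (+ t) unit
  ...   | z≈s , z≈t =
    z %ℕ (P ℕ.* Q) , n%ℕd<d z (P ℕ.* Q) ,
    residue-of-reduction P (P ℕ.* Q) z (m∣m*n Q) s<P z≈s ,
    residue-of-reduction Q (P ℕ.* Q) z (n∣m*n P) t<Q z≈t
    where z = + s * (β * + Q) + + t * (α * + P)

  crt-unique : ∀ {x y} → x < P ℕ.* Q → y < P ℕ.* Q → x % P ≡ y % P → x % Q ≡ y % Q → x ≡ y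
  crt-unique {x} {y} x<PQ y<PQ x≡y[P] x≡y[Q] = trans (sym (m<n⇒m%n≡m x<PQ))
    (residue-unique (P ℕ.* Q) (+ x) y<PQ
      (mod-coprime-* cop (same-residue⇒mod P (+ x) (+ y) x≡y[P])
                         (same-residue⇒mod Q (+ x) (+ y) x≡y[Q])))

  has-residues : ℕ → ℕ → ℕ → ℤ
  has-residues x s t = 𝟙 (does (s ℕ.≟ x % P)) * 𝟙 (does (t ℕ.≟ x % Q))

  residue-test : ℕ → ℕ → ℕ → Bool
  residue-test s t x = does (s ℕ.≟ x % P) ∧ does (t ℕ.≟ x % Q)

  residue-test-sound : ∀ {s t} x → T (residue-test s t x) → s ≡ x % P × t ≡ x % Q
  residue-test-sound {s} {t} x holds =
    let (s-test , t-test) = Equivalence.to (T-∧ {does (s ℕ.≟ x % P)}) holds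
    in ℕP.≡ᵇ⇒≡ s (x % P) s-test , ℕP.≡ᵇ⇒≡ t (x % Q) t-test

  residue-test-complete : ∀ {s t} x → s ≡ x % P → t ≡ x % Q → T (residue-test s t x)
  residue-test-complete {s} {t} x s≡ t≡ =
    Equivalence.from (T-∧ {does (s ℕ.≟ x % P)}) (ℕP.≡⇒≡ᵇ s (x % P) s≡ , ℕP.≡⇒≡ᵇ t (x % Q) t≡)

  crt-count : ∀ {s t} → s < P → t < Q → sumℤ (upTo (P ℕ.* Q)) (λ x → has-residues x s t) ≡ + 1
  crt-count {s} {t} s<P t<Q = count-via (crt-exists s<P t<Q)
    where
      count-via : (∃ λ w → w < P ℕ.* Q × w % P ≡ s × w % Q ≡ t) →
        sumℤ (upTo (P ℕ.* Q)) (λ x → has-residues x s t) ≡ + 1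
      count-via (w , w<PQ , w≡s , w≡t) =
        trans (sum-cong (upTo (P ℕ.* Q)) (λ x → sym (𝟙-∧ (does (s ℕ.≟ x % P)) _)))
          (count-unique ℕ._≟_ (upTo (P ℕ.* Q)) (residue-test s t) (upTo⁺ (P ℕ.* Q))
            (∈-upTo⁺ w<PQ) only-w (λ { {x} _ refl → residue-test-complete x (sym w≡s) (sym w≡t) }))
        where
          only-w : ∀ {x} → x ∈ upTo (P ℕ.* Q) → T (residue-test s t x) → x ≡ w
          only-w {x} x∈ holds = let (s≡x , t≡x) = residue-test-sound x holds in
            crt-unique (∈-upTo⁻ x∈) w<PQ (trans (sym s≡x) (sym w≡s))
                                         (trans (sym t≡x) (sym w≡t))

  pick-residues : ∀ x (G : ℕ → ℕ → ℤ) →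
    sumℤ (upTo P) (λ s → sumℤ (upTo Q) (λ t → has-residues x s t * G s t)) ≡ G (x % P) (x % Q)
  pick-residues x G = begin
    sumℤ (upTo P) (λ s → sumℤ (upTo Q) (λ t → has-residues x s t * G s t))
      ≡⟨ sum-cong (upTo P) (λ s →
           trans (sum-cong (upTo Q) (λ t → *-assoc (δP s) (δQ t) (G s t)))
                 (sum-*ˡ (upTo Q) (δP s) (λ t → δQ t * G s t))) ⟩
    sumℤ (upTo P) (λ s → δP s * sumℤ (upTo Q) (λ t → δQ t * G s t))
      ≡⟨ sum-cong (upTo P) (λ s → cong (δP s *_)
           (sum-delta ℕ._≟_ (upTo Q) (G s) (upTo⁺ Q) (∈-upTo⁺ (m%n<n x Q)))) ⟩
    sumℤ (upTo P) (λ s → δP s * G s (x % Q))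
      ≡⟨ sum-delta ℕ._≟_ (upTo P) (λ s → G s (x % Q)) (upTo⁺ P) (∈-upTo⁺ (m%n<n x P)) ⟩
    G (x % P) (x % Q) ∎
    where
      δP δQ : ℕ → ℤ
      δP s = 𝟙 (does (s ℕ.≟ x % P))
      δQ t = 𝟙 (does (t ℕ.≟ x % Q))

  crt-sum : ∀ (G : ℕ → ℕ → ℤ) →
    sumℤ (upTo (P ℕ.* Q)) (λ x → G (x % P) (x % Q)) ≡ sumℤ (upTo P) (λ s → sumℤ (upTo Q) (G s))
  crt-sum G = sym (begin
    sumℤ (upTo P) (λ s → sumℤ (upTo Q) (G s))
      ≡⟨ sum-cong-∈ (upTo P) (λ s∈ → sum-cong-∈ (upTo Q) (λ t∈ → weight-once s∈ t∈)) ⟩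
    sumℤ (upTo P) (λ s → sumℤ (upTo Q) (λ t → sumℤ (upTo (P ℕ.* Q)) (λ x → D x s t)))
      ≡⟨ sum-cong (upTo P) (λ s → sum-swap (upTo Q) (upTo (P ℕ.* Q)) (λ t x → D x s t)) ⟩
    sumℤ (upTo P) (λ s → sumℤ (upTo (P ℕ.* Q)) (λ x → sumℤ (upTo Q) (D x s)))
      ≡⟨ sum-swap (upTo P) (upTo (P ℕ.* Q)) (λ s x → sumℤ (upTo Q) (D x s)) ⟩
    sumℤ (upTo (P ℕ.* Q)) (λ x → sumℤ (upTo P) (λ s → sumℤ (upTo Q) (D x s)))
      ≡⟨ sum-cong (upTo (P ℕ.* Q)) (λ x → pick-residues x G) ⟩
    sumℤ (upTo (P ℕ.* Q)) (λ x → G (x % P) (x % Q)) ∎)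
    where
      D : ℕ → ℕ → ℕ → ℤ
      D x s t = has-residues x s t * G s t
      -- each residue pair is attained once, so G s t is recovered as a sum over x
      weight-once : ∀ {s t} → s ∈ upTo P → t ∈ upTo Q →
        G s t ≡ sumℤ (upTo (P ℕ.* Q)) (λ x → D x s t)
      weight-once {s} {t} s∈ t∈ = begin
        G s t                                                     ≡⟨ sym (*-identityˡ (G s t)) ⟩
        + 1 * G s t
          ≡⟨ cong (_* G s t) (sym (crt-count (∈-upTo⁻ s∈) (∈-upTo⁻ t∈))) ⟩
        sumℤ (upTo (P ℕ.* Q)) (λ x → has-residues x s t) * G s t
          ≡⟨ sym (sum-*ʳ (upTo (P ℕ.* Q)) (G s t) (λ x → has-residues x s t)) ⟩
        sumℤ (upTo (P ℕ.* Q)) (λ x → D x s t)                     ∎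

  crt-sum-box : ∀ n (F : Vec ℕ n → Vec ℕ n → ℤ) →
    sumℤ (allVecs n (P ℕ.* Q)) (λ a → F (Vec.map (_% P) a) (Vec.map (_% Q) a))
      ≡ sumℤ (allVecs n P) (λ u → sumℤ (allVecs n Q) (F u))
  crt-sum-box zero F = sym (+-identityʳ _)
  crt-sum-box (suc n) F = begin
    sumℤ (allVecs (suc n) (P ℕ.* Q)) (λ a → F (Vec.map (_% P) a) (Vec.map (_% Q) a))
      ≡⟨ sum-box-suc n (P ℕ.* Q) (λ a → F (Vec.map (_% P) a) (Vec.map (_% Q) a)) ⟩
    sumℤ (upTo (P ℕ.* Q)) (λ x → H (x % P) (x % Q))
      ≡⟨ crt-sum H ⟩
    sumℤ (upTo P) (λ s → sumℤ (upTo Q) (H s))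
      ≡⟨ sum-cong (upTo P) (λ s → sum-cong (upTo Q) (λ t → crt-sum-box n (F′ s t))) ⟩
    sumℤ (upTo P) (λ s → sumℤ (upTo Q) (λ t → sumℤ (allVecs n P) (λ u → sumℤ (allVecs n Q) (F′ s t u))))
      ≡⟨ sum-cong (upTo P) (λ s →
           sum-swap (upTo Q) (allVecs n P) (λ t u → sumℤ (allVecs n Q) (F′ s t u))) ⟩
    sumℤ (upTo P) (λ s → sumℤ (allVecs n P) (λ u → sumℤ (upTo Q) (λ t → sumℤ (allVecs n Q) (F′ s t u))))
      ≡⟨ sum-cong (upTo P) (λ s →
           sum-cong (allVecs n P) (λ u → sym (sum-box-suc n Q (F (s ∷ u))))) ⟩
    sumℤ (upTo P) (λ s → sumℤ (allVecs n P) (λ u → sumℤ (allVecs (suc n) Q) (F (s ∷ u))))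
      ≡⟨ sym (sum-box-suc n P (λ u → sumℤ (allVecs (suc n) Q) (F u))) ⟩
    sumℤ (allVecs (suc n) P) (λ u → sumℤ (allVecs (suc n) Q) (F u)) ∎
    where
      F′ : ℕ → ℕ → Vec ℕ n → Vec ℕ n → ℤ
      F′ s t u v = F (s ∷ u) (t ∷ v)
      H : ℕ → ℕ → ℤ
      H s t = sumℤ (allVecs n (P ℕ.* Q)) (λ a → F (s ∷ Vec.map (_% P) a) (t ∷ Vec.map (_% Q) a))

  crt-product-sum : ∀ n (g h : Vec ℕ n → ℤ) →
    (∀ a → g a ≡ g (Vec.map (_% P) a)) → (∀ a → h a ≡ h (Vec.map (_% Q) a)) →
    sumℤ (allVecs n (P ℕ.* Q)) (λ a → g a * h a) ≡ sumℤ (allVecs n P) g * sumℤ (allVecs n Q) h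
  crt-product-sum n g h g-periodic h-periodic = begin
    sumℤ (allVecs n (P ℕ.* Q)) (λ a → g a * h a)
      ≡⟨ sum-cong (allVecs n (P ℕ.* Q)) (λ a → cong₂ _*_ (g-periodic a) (h-periodic a)) ⟩
    sumℤ (allVecs n (P ℕ.* Q)) (λ a → g (Vec.map (_% P) a) * h (Vec.map (_% Q) a))
      ≡⟨ crt-sum-box n (λ u v → g u * h v) ⟩
    sumℤ (allVecs n P) (λ u → sumℤ (allVecs n Q) (λ v → g u * h v))
      ≡⟨ sum-cong (allVecs n P) (λ u → sum-*ˡ (allVecs n Q) (g u) h) ⟩
    sumℤ (allVecs n P) (λ u → g u * sumℤ (allVecs n Q) h)
      ≡⟨ sum-*ʳ (allVecs n P) (sumℤ (allVecs n Q) h) g ⟩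
    sumℤ (allVecs n P) g * sumℤ (allVecs n Q) h ∎

module CoprimePowers where

  open import Data.Nat as ℕ using (zero; suc)
  open import Data.Nat.Properties using (<-cmp)
  open import Data.Nat.Divisibility using (∣-trans)
  open import Data.Nat.Coprimality using (coprime-divisor; prime⇒coprime; 1-coprimeTo)
  import Data.Nat.Coprimality as Coprime
  open import Data.Product using (_,_)
  open import Data.Empty using (⊥-elim)
  open import Relation.Binary.Definitions using (tri<; tri≈; tri>)

  coprime-* : ∀ {a b c} → Coprime a b → Coprime a c → Coprime a (b ℕ.* c)
  coprime-* {a} {b} a⊥b a⊥c {i} (i∣a , i∣bc) = a⊥c (i∣a , coprime-divisor i⊥b i∣bc)
    where
      i⊥b : Coprime i b
      i⊥b (k∣i , k∣b) = a⊥b (∣-trans k∣i i∣a , k∣b)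

  coprime-^ʳ : ∀ {a b} k → Coprime a b → Coprime a (b ^ k)
  coprime-^ʳ {a} zero _ = Coprime.sym (1-coprimeTo a)
  coprime-^ʳ (suc k) a⊥b = coprime-* a⊥b (coprime-^ʳ k a⊥b)

  coprime-^ : ∀ {a b} k l → Coprime a b → Coprime (a ^ k) (b ^ l)
  coprime-^ k l a⊥b = Coprime.sym (coprime-^ʳ k (Coprime.sym (coprime-^ʳ l a⊥b)))

  -- Distinct primes are coprime: the smaller one is coprime to the larger prime.
  distinct-primes-coprime : ∀ {p q} → Prime p → Prime q → p ≢ q → Coprime p q
  distinct-primes-coprime {p} {q} p-prime q-prime p≢q with <-cmp p q
  ... | tri< p<q _ _ = Coprime.sym (prime⇒coprime q-prime {{prime⇒nonZero p-prime}} p<q)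
  ... | tri≈ _ p≡q _ = ⊥-elim (p≢q p≡q)
  ... | tri> _ _ q<p = prime⇒coprime p-prime {{prime⇒nonZero q-prime}} q<p

-- Folding along a list L of
-- indices mirrors `prodℕ` and `prodℤ`, which fold along the list of all indices.
module SubsetProducts {r n : ℕ} (S : Subset r) (m : Fin r → ℕ)
    (m-nonzero : ∀ j → NonZero (m j))
    (m-coprime : ∀ {i j} → i ≢ j → Coprime (m i) (m j))
    (f : Fin r → Vec ℕ n → ℤ)
    (f-periodic : ∀ j M {{_ : NonZero M}} → m j ∣ℕ M → ∀ a → f j a ≡ f j (Data.Vec.map (_% M) a))
    (f-sum-zero : ∀ j → sumℤ (allVecs n (m j)) (f j) ≡ + 0) where

  open CoprimePowers using (coprime-*)
  import Data.Nat as ℕ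
  import Data.Nat.Properties as ℕP
  open import Data.Nat.Divisibility using (∣-refl; ∣-trans; m∣m*n; n∣m*n)
  open import Data.Nat.Coprimality using (1-coprimeTo)
  import Data.Nat.Coprimality as Coprime
  import Data.Integer as ℤ
  open import Data.Fin.Subset using (_∈_)
  open import Data.Fin.Subset.Properties using (_∈?_)
  open import Data.List using (List; []; _∷_; foldr)
  open import Data.List.Relation.Unary.Any using (Any; here; there)
  open import Data.List.Relation.Unary.All using (All; []; _∷_)
  open import Data.List.Relation.Unary.AllPairs using (AllPairs; _∷_)
  import Data.Vec as Vec
  open import Data.Bool using (true; false; if_then_else_)
  open import Data.Empty using (⊥-elim)
  open import Relation.Nullary using (yes; no; does)
  open import Relation.Binary.PropositionalEquality

  instance
    m-nonzero-instance : ∀ {j} → NonZero (m j)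
    m-nonzero-instance {j} = m-nonzero j

  modulus : List (Fin r) → ℕ
  modulus L = foldr (λ j acc → if does (j ∈? S) then m j ℕ.* acc else acc) 1 L

  product : List (Fin r) → Vec ℕ n → ℤ
  product L a = foldr (λ j acc → if does (j ∈? S) then f j a ℤ.* acc else acc) (+ 1) L

  modulus-nonzero : ∀ L → NonZero (modulus L)
  modulus-nonzero [] = _
  modulus-nonzero (j ∷ L) with does (j ∈? S)
  ... | true = ℕP.m*n≢0 (m j) (modulus L) {{m-nonzero j}} {{modulus-nonzero L}}
  ... | false = modulus-nonzero L

  modulus-coprime : ∀ j L → All (j ≢_) L → Coprime (m j) (modulus L)
  modulus-coprime j [] [] = Coprime.sym (1-coprimeTo (m j))
  modulus-coprime j (k ∷ L) (j≢k ∷ j∉L) with does (k ∈? S)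
  ... | true = coprime-* (m-coprime j≢k) (modulus-coprime j L j∉L)
  ... | false = modulus-coprime j L j∉L

  product-periodic : ∀ L M {{_ : NonZero M}} → modulus L ∣ℕ M →
    ∀ a → product L a ≡ product L (Vec.map (_% M) a)
  product-periodic [] M _ a = refl
  product-periodic (j ∷ L) M L∣M a with does (j ∈? S)
  ... | true = cong₂ ℤ._*_ (f-periodic j M (∣-trans (m∣m*n (modulus L)) L∣M) a)
                           (product-periodic L M (∣-trans (n∣m*n (m j)) L∣M) a)
  ... | false = product-periodic L M L∣M a

  -- If L has no repetitions and meets S, the product sums to zero over its box: split off
  -- the first index of S in L by the Chinese remainder theorem; its factor sums to zero.
  product-sum-zero : ∀ L → AllPairs _≢_ L → Any (_∈ S) L →
    sumℤ (allVecs n (modulus L)) (product L) ≡ + 0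
  product-sum-zero (j ∷ L) (j∉L ∷ distinct) meets with j ∈? S
  ... | yes _ = trans
    (ChineseRemainder.crt-product-sum (m j) (modulus L) {{m-nonzero j}} {{modulus-nonzero L}}
      (modulus-coprime j L j∉L) n (f j) (product L)
      (f-periodic j (m j) ∣-refl) (product-periodic L (modulus L) {{modulus-nonzero L}} ∣-refl))
    (cong (ℤ._* sumℤ (allVecs n (modulus L)) (product L)) (f-sum-zero j))
  ... | no j∉S with meets
  ...   | here j∈S = ⊥-elim (j∉S j∈S)
  ...   | there L-meets = product-sum-zero L distinct L-meets

open CoprimePowers using (coprime-^; distinct-primes-coprime)

lemma3p4 : (b d q m : ℕ) → 1 ≤ b → 2 ≤ d → 1 ≤ q → 2 ≤ m → Coprime b q →
    (r : ℕ) (p e : Fin r → ℕ) → (∀ j → Prime (p j)) → (∀ j → 1 ≤ e j) →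
    Injective _≡_ _≡_ p → q ≡ prodAll (λ j → p j ^ e j) →
    (S : Subset r) → Nonempty S →
    sumℤ (allVecs (m ∸ 1) (cS p e S)) (λ a → AS b d p e S a) ≡ + 0
lemma3p4 b d q m _ _ _ _ _ r p e primes _ p-injective _ S (j , j∈S) =
  SubsetProducts.product-sum-zero {r} {m ∸ 1} S prime-power prime-power-nonzero prime-powers-coprime
    (λ i a → Aloc b d a (prime-power i))
    (λ i M i∣M a → LocalFactor.local-periodic b d (prime-power i) {{prime-power-nonzero i}} M i∣M a)
    (λ i → LocalFactor.local-sum-zero b d (prime-power i) {{prime-power-nonzero i}} (m ∸ 1))
    (allFin r) (allFin⁺ r) (Any.map (λ { refl → j∈S }) (∈-allFin j))
  where
    prime-power : Fin r → ℕ
    prime-power i = p i ^ e i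

    prime-power-nonzero : ∀ i → NonZero (prime-power i)
    prime-power-nonzero i = m^n≢0 (p i) (e i) {{prime⇒nonZero (primes i)}}

    prime-powers-coprime : ∀ {i k} → i ≢ k → Coprime (prime-power i) (prime-power k)
    prime-powers-coprime {i} {k} i≢k = coprime-^ (e i) (e k)
      (distinct-primes-coprime (primes i) (primes k) (i≢k ∘ p-injective))
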